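{- Let $n\ge0$, $\alpha=(\alpha_1,\ldots,\alpha_k)$ a composition of $n$ and $F\in\Sigma_n$. Then $n_\alpha(F)=n_{\operatorname{rev}\alpha}(F)$, where $\operatorname{rev}\alpha=(\alpha_k,\ldots,\alpha_1)$.
   Context: A set composition of $[n]=\{1,\ldots,n\}$ is a tuple $F=(F_1,\ldots,F_m)$ of nonempty pairwise disjoint sets with union $[n]$, of type $(|F_1|,\ldots,|F_m|)$; $\Sigma_n$ is the set of all of them. $F\preceq G$ means every block of $F$ is a subset of some block of $G$. For a composition $\beta$ of $n$, $n_\beta(F)=\#\{G\in\Sigma_n:F\preceq G,\ \operatorname{type}G=\beta\}$. -}

module Defs where

open import Data.Nat using (ℕ; zero; suc; _>_; _≟_)
open import Data.Fin using (Fin; zero; suc)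
open import Data.Fin.Properties using (all?; any?)
import Data.Fin.Properties as FinP
open import Data.List using (List; []; _∷_; length; filter; map; concatMap; reverse; allFin)
open import Data.Nat.ListAction using (sum)
open import Data.List.Relation.Unary.All using (All)
open import Data.Product using (Σ; ∃; _×_; _,_)
open import Relation.Binary.PropositionalEquality using (_≡_)
open import Relation.Nullary using (Dec; yes; no; ¬_)
open import Relation.Nullary.Decidable using (_×-dec_; _→-dec_)
import Data.List.Properties as ListP

IsComposition : ℕ → List ℕ → Set
IsComposition n α = All (λ a → a > 0) α × sum α ≡ n

rev : List ℕ → List ℕ
rev = reverse

-- A tuple of m pairwise disjoint sets with union [n] is encoded by the
-- block-index map  f : Fin n → Fin m  (element x lies in block f x).
-- Blocks are nonempty iff f is surjective.
Surjective : ∀ {n m} → (Fin n → Fin m) → Set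
Surjective {n} {m} f = ∀ (i : Fin m) → ∃ λ (x : Fin n) → f x ≡ i

record SetComp (n : ℕ) : Set where
  constructor setComp
  field
    nblocks : ℕ
    block   : Fin n → Fin nblocks
    surj    : Surjective block

blockSize : ∀ {n m} → (Fin n → Fin m) → Fin m → ℕ
blockSize {n} g j = length (filter (λ x → g x FinP.≟ j) (allFin n))

typeOf : ∀ {n m} → (Fin n → Fin m) → List ℕ
typeOf {m = m} g = map (blockSize g) (allFin m)

Refines : ∀ {n m k} → (Fin n → Fin m) → (Fin n → Fin k) → Set
Refines {n} {m} {k} f g =
  ∀ (i : Fin m) → ∃ λ (j : Fin k) → ∀ (x : Fin n) → f x ≡ i → g x ≡ j

allFuns : (n k : ℕ) → List (Fin n → Fin k)
allFuns zero    k = (λ ()) ∷ []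
allFuns (suc n) k =
  concatMap (λ (v : Fin k) → map (λ g → cons v g) (allFuns n k)) (allFin k)
  where
    cons : Fin k → (Fin n → Fin k) → Fin (suc n) → Fin k
    cons v g zero    = v
    cons v g (suc x) = g x

surj? : ∀ {n m} (f : Fin n → Fin m) → Dec (Surjective f)
surj? f = all? λ i → any? λ x → f x FinP.≟ i

refines? : ∀ {n m k} (f : Fin n → Fin m) (g : Fin n → Fin k) → Dec (Refines f g)
refines? f g = all? λ i → any? λ j → all? λ x → (f x FinP.≟ i) →-dec (g x FinP.≟ j)

-- A map g : Fin n → Fin (length β) is a set composition G of type β
-- that is refined by F.  (A set composition of type β has exactly
-- length β blocks, so the G's counted are exactly these maps.)
Counted : ∀ {n m} (f : Fin n → Fin m) (β : List ℕ) → (Fin n → Fin (length β)) → Set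
Counted f β g = Surjective g × Refines f g × typeOf g ≡ β

counted? : ∀ {n m} (f : Fin n → Fin m) (β : List ℕ) (g : Fin n → Fin (length β)) → Dec (Counted f β g)
counted? f β g = surj? g ×-dec (refines? f g ×-dec ListP.≡-dec _≟_ (typeOf g) β)

nβ : ∀ {n} → List ℕ → SetComp n → ℕ
nβ {n} β F = length (filter (counted? (SetComp.block F) β) (allFuns n (length β)))

{-# OPTIONS --safe #-}
-- Post-composing a block map g : [n] → [k] with the order-reversing permutation of
-- [k] keeps it surjective and refined by F, and reverses its type; being an
-- involution, it matches the set compositions of type α with those of type rev α.
-- Since n_β counts block maps inside an explicit enumeration of all maps
-- [n] → [k], whose elements can only be compared pointwise, the real work is that
-- counting a ≗-invariant predicate over this enumeration is unchanged by
-- post-composition with any permutation of [k]; by induction on n this reduces to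
-- reindexing a finite sum over the image of the first element.
module Submission where

open import Defs
open import Level using (Level)
open import Data.Nat using (ℕ; zero; suc; _+_; _≟_)
open import Data.Nat.Properties using (+-0-commutativeMonoid)
open import Data.Fin using (Fin; zero; suc; opposite; fromℕ; inject₁)
open import Data.Fin.Properties using (opposite-involutive)
open import Data.Fin.Permutation as Perm using (Permutation′; _⟨$⟩ʳ_)
open import Data.List using (List; []; _∷_; _++_; _∷ʳ_; length; filter; map; concatMap; reverse; tabulate; allFin)
open import Data.List.Properties
  using (filter-++; filter-≐; length-++; length-reverse; reverse-++; reverse-involutive; map-cong; map-tabulate; ≡-dec)
import Data.Vec.Functional as Vector
open import Data.Vec.Functional.Properties using (∷-cong)
open import Data.Product using (_×_; _,_)
open import Function using (_∘_; id)
open import Relation.Binary.Definitions using (_Respects_)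
open import Relation.Binary.PropositionalEquality
  using (_≡_; _≗_; refl; sym; trans; cong; subst; module ≡-Reasoning)
open import Relation.Nullary using (yes; no)
open import Relation.Nullary.Decidable using (_×-dec_)
open import Relation.Unary using (Pred; Decidable; _≐_)
open import Algebra.Properties.CommutativeMonoid.Sum +-0-commutativeMonoid
  using (sum-syntax; sum-cong-≗; sum-permute)

open ≡-Reasoning

private
  variable
    a ℓ ℓ′ : Level
    A B : Set a
    n m k : ℕ

count : {P : Pred A ℓ} → Decidable P → List A → ℕ
count P? = length ∘ filter P?

module _ {P : Pred B ℓ} (P? : Decidable P) where

  count-++ : (xs ys : List B) → count P? (xs ++ ys) ≡ count P? xs + count P? ys
  count-++ xs ys = trans (cong length (filter-++ P? xs ys)) (length-++ (filter P? xs))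

  count-map : (f : A → B) (xs : List A) → count P? (map f xs) ≡ count (P? ∘ f) xs
  count-map f [] = refl
  count-map f (x ∷ xs) with P? (f x)
  ... | yes _ = cong suc (count-map f xs)
  ... | no _  = count-map f xs

  count-concatMap-tabulate : (f : A → List B) (g : Fin k → A) →
    count P? (concatMap f (tabulate g)) ≡ ∑[ i < k ] count P? (f (g i))
  count-concatMap-tabulate {k = zero}  f g = refl
  count-concatMap-tabulate {k = suc k} f g =
    trans (count-++ (f (g zero)) _) (cong (_ +_) (count-concatMap-tabulate f (g ∘ suc)))

count-≐ : {P : Pred A ℓ} {Q : Pred A ℓ′} (P? : Decidable P) (Q? : Decidable Q) →
  P ≐ Q → (xs : List A) → count P? xs ≡ count Q? xs
count-≐ P? Q? P≐Q xs = cong length (filter-≐ P? Q? P≐Q xs)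

module _ {P : Pred (Fin (suc n) → Fin k) ℓ} (P? : Decidable P) (resp : P Respects _≗_) where

  count-concatMap-cons : (cons : Fin k → (Fin n → Fin k) → Fin (suc n) → Fin k) →
    (∀ v g → cons v g ≗ v Vector.∷ g) →
    count P? (concatMap (λ v → map (cons v) (allFuns n k)) (allFin k)) ≡
    ∑[ v < k ] count (P? ∘ (v Vector.∷_)) (allFuns n k)
  count-concatMap-cons cons cons≗∷ =
    trans (count-concatMap-tabulate P? {k = k} _ id) (sum-cong-≗ λ v →
      trans (count-map P? (cons v) (allFuns n k))
            (count-≐ _ _ (resp (cons≗∷ v _) , resp (sym ∘ cons≗∷ v _)) (allFuns n k)))

  -- allFuns conses with a where-bound function, reachable only through unification.
  count-allFuns-suc : count P? (allFuns (suc n) k) ≡ ∑[ v < k ] count (P? ∘ (v Vector.∷_)) (allFuns n k)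
  count-allFuns-suc = count-concatMap-cons _ (λ v g → ∷-cong refl λ _ → refl)

count-allFuns-permute : (π : Permutation′ k) {P : Pred (Fin n → Fin k) ℓ} (P? : Decidable P) →
  P Respects _≗_ → count P? (allFuns n k) ≡ count (λ g → P? ((π ⟨$⟩ʳ_) ∘ g)) (allFuns n k)
count-allFuns-permute {k = k} {n = zero} π P? resp =
  count-≐ P? (λ g → P? ((π ⟨$⟩ʳ_) ∘ g)) (resp (λ ()) , resp (λ ())) (allFuns zero k)
count-allFuns-permute {k = k} {n = suc n} π P? resp = begin
  count P? (allFuns (suc n) k)
    ≡⟨ count-allFuns-suc P? resp ⟩
  ∑[ v < k ] count (P? ∘ (v Vector.∷_)) (allFuns n k)
    ≡⟨ sum-permute _ π ⟩
  ∑[ v < k ] count (P? ∘ (σ v Vector.∷_)) (allFuns n k)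
    ≡⟨ sum-cong-≗ (λ v → count-allFuns-permute π (P? ∘ (σ v Vector.∷_)) (resp ∘ ∷-cong refl)) ⟩
  ∑[ v < k ] count (λ g → P? (σ v Vector.∷ σ ∘ g)) (allFuns n k)
    ≡⟨ sum-cong-≗ (λ v → count-≐ (λ g → P? (σ ∘ (v Vector.∷ g))) _ (resp σ∘∷ , resp (sym ∘ σ∘∷)) (allFuns n k)) ⟨
  ∑[ v < k ] count (λ g → P? (σ ∘ (v Vector.∷ g))) (allFuns n k)
    ≡⟨ count-allFuns-suc _ (resp ∘ (cong σ ∘_)) ⟨
  count (λ g → P? (σ ∘ g)) (allFuns (suc n) k) ∎
  where
  σ : Fin k → Fin k
  σ = π ⟨$⟩ʳ_

  σ∘∷ : ∀ {v} {g : Fin n → Fin k} → σ ∘ (v Vector.∷ g) ≗ σ v Vector.∷ σ ∘ g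
  σ∘∷ = ∷-cong refl (λ _ → refl)

tabulate-∷ʳ : (h : Fin (suc k) → A) → tabulate h ≡ tabulate (h ∘ inject₁) ∷ʳ h (fromℕ k)
tabulate-∷ʳ {k = zero}  h = refl
tabulate-∷ʳ {k = suc k} h = cong (h zero ∷_) (tabulate-∷ʳ (h ∘ suc))

tabulate-opposite : (h : Fin k → A) → tabulate (h ∘ opposite) ≡ reverse (tabulate h)
tabulate-opposite {k = zero}  h = refl
tabulate-opposite {k = suc k} h = begin
  h (fromℕ k) ∷ tabulate (h ∘ inject₁ ∘ opposite)     ≡⟨ cong (h (fromℕ k) ∷_) (tabulate-opposite (h ∘ inject₁)) ⟩
  h (fromℕ k) ∷ reverse (tabulate (h ∘ inject₁))      ≡⟨ reverse-++ (tabulate (h ∘ inject₁)) _ ⟨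
  reverse (tabulate (h ∘ inject₁) ∷ʳ h (fromℕ k))     ≡⟨ cong reverse (tabulate-∷ʳ h) ⟨
  reverse (tabulate h)                                ∎

opposite-≡-flip : {i j : Fin k} → opposite i ≡ j → i ≡ opposite j
opposite-≡-flip {i = i} refl = sym (opposite-involutive i)

blockSize-cong : {g h : Fin n → Fin k} → g ≗ h → ∀ j → blockSize g j ≡ blockSize h j
blockSize-cong {n = n} g≗h j = count-≐ _ _ (trans (sym (g≗h _)) , trans (g≗h _)) (allFin n)

blockSize-opposite : (g : Fin n → Fin k) (j : Fin k) → blockSize (opposite ∘ g) j ≡ blockSize g (opposite j)
blockSize-opposite {n = n} g j = count-≐ _ _ (opposite-≡-flip , sym ∘ opposite-≡-flip ∘ sym) (allFin n)

typeOf-cong : {g h : Fin n → Fin k} → g ≗ h → typeOf g ≡ typeOf h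
typeOf-cong g≗h = map-cong (blockSize-cong g≗h) _

typeOf-opposite : (g : Fin n → Fin k) → typeOf (opposite ∘ g) ≡ reverse (typeOf g)
typeOf-opposite {k = k} g = begin
  map (blockSize (opposite ∘ g)) (allFin k)   ≡⟨ map-cong (blockSize-opposite g) (allFin k) ⟩
  map (blockSize g ∘ opposite) (allFin k)     ≡⟨ map-tabulate id _ ⟩
  tabulate (blockSize g ∘ opposite)           ≡⟨ tabulate-opposite (blockSize g) ⟩
  reverse (tabulate (blockSize g))            ≡⟨ cong reverse (map-tabulate id (blockSize g)) ⟨
  reverse (map (blockSize g) (allFin k))      ∎

-- Counted with the number of blocks k as a parameter, so that β and reverse β can be
-- counted over the same allFuns n k.
Coarsening : (f : Fin n → Fin m) (β : List ℕ) → (Fin n → Fin k) → Set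
Coarsening f β g = Surjective g × Refines f g × typeOf g ≡ β

coarsening? : (f : Fin n → Fin m) (β : List ℕ) → Decidable (Coarsening {k = k} f β)
coarsening? f β g = surj? g ×-dec (refines? f g ×-dec ≡-dec _≟_ (typeOf g) β)

coarsening-respects-≗ : (f : Fin n → Fin m) (β : List ℕ) → Coarsening {k = k} f β Respects _≗_
coarsening-respects-≗ f β g≗h (surj , refines , type) =
  (λ i → let x , gx≡i = surj i in x , trans (sym (g≗h x)) gx≡i) ,
  (λ i → let j , fx≡i⇒gx≡j = refines i in j , λ x → trans (sym (g≗h x)) ∘ fx≡i⇒gx≡j x) ,
  trans (sym (typeOf-cong g≗h)) type

coarsening-opposite : (f : Fin n → Fin m) (β : List ℕ) {g : Fin n → Fin k} →
  Coarsening f β g → Coarsening f (reverse β) (opposite ∘ g)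
coarsening-opposite f β {g} (surj , refines , type) =
  (λ i → let x , gx≡i′ = surj (opposite i) in x , sym (opposite-≡-flip (sym gx≡i′))) ,
  (λ i → let j , fx≡i⇒gx≡j = refines i in opposite j , λ x → cong opposite ∘ fx≡i⇒gx≡j x) ,
  trans (typeOf-opposite g) (cong reverse type)

coarsening-opposite⁻ : (f : Fin n → Fin m) (β : List ℕ) {g : Fin n → Fin k} →
  Coarsening f (reverse β) (opposite ∘ g) → Coarsening f β g
coarsening-opposite⁻ f β c =
  coarsening-respects-≗ f β (opposite-involutive ∘ _)
    (subst (λ γ → Coarsening f γ _) (reverse-involutive β) (coarsening-opposite f (reverse β) c))

count-coarsening-reverse : (f : Fin n → Fin m) (β : List ℕ) (k : ℕ) →
  count (coarsening? f β) (allFuns n k) ≡ count (coarsening? f (reverse β)) (allFuns n k)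
count-coarsening-reverse {n = n} f β k = begin
  count (coarsening? f β) (allFuns n k)
    ≡⟨ count-≐ _ _ (coarsening-opposite f β , coarsening-opposite⁻ f β) (allFuns n k) ⟩
  count (λ g → coarsening? f (reverse β) (opposite ∘ g)) (allFuns n k)
    ≡⟨ count-allFuns-permute Perm.reverse (coarsening? f (reverse β)) (coarsening-respects-≗ f (reverse β)) ⟨
  count (coarsening? f (reverse β)) (allFuns n k) ∎

proposition4p27 : (n : ℕ) (α : List ℕ) → IsComposition n α → (F : SetComp n) →
    nβ α F ≡ nβ (rev α) F
proposition4p27 n α _ F = begin
  nβ α F
    ≡⟨ count-coarsening-reverse f α (length α) ⟩
  count (coarsening? f (rev α)) (allFuns n (length α))
    ≡⟨ cong (count (coarsening? f (rev α)) ∘ allFuns n) (length-reverse α) ⟨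
  nβ (rev α) F ∎
  where f = SetComp.block F
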